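{- Let $T$ be an out-tree. Then $|\mathrm{BrSucc}(T)|\leq 2|\mathrm{Leaf}(T)|-2$.
   Context: An out-tree is a digraph whose underlying undirected graph is a tree and which has exactly one vertex of in-degree zero (its root), all other vertices having in-degree one. $\mathrm{Leaf}(T)$ is the set of vertices of out-degree $0$; a branch vertex is a vertex of out-degree at least $2$; $\mathrm{BrSucc}(T)$ is the set of vertices having a branch vertex of $T$ as in-neighbor. -}

module Defs where

open import Data.Nat using (ℕ; zero; suc; _≤_; _≡ᵇ_; _≤ᵇ_)
open import Data.Bool using (Bool; true; false; T; _∧_)
open import Data.Bool.ListAction using (any)
open import Data.Fin using (Fin)
open import Data.List using (List; []; _∷_; _++_; length; filterᵇ; allFin)
open import Data.List.Relation.Unary.Linked using (Linked)
open import Data.List.Relation.Unary.Unique.Propositional using (Unique)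
open import Data.Product using (Σ; _×_)
open import Data.Sum using (_⊎_)
open import Relation.Binary.PropositionalEquality using (_≡_; _≢_)

-- A (loopless) digraph on the vertex set Fin n; arc u v = true iff u → v is an arc.
-- Parallel arcs are impossible in this representation.
record Digraph : Set where
  field
    n        : ℕ
    arc      : Fin n → Fin n → Bool
    loopless : ∀ v → arc v v ≡ false

module _ (D : Digraph) where
  open Digraph D

  Vertex : Set
  Vertex = Fin n

  countV : (Vertex → Bool) → ℕ
  countV p = length (filterᵇ p (allFin n))

  outdeg : Vertex → ℕ
  outdeg v = countV (λ w → arc v w)

  indeg : Vertex → ℕ
  indeg v = countV (λ u → arc u v)

  Adj : Vertex → Vertex → Set
  Adj u v = T (arc u v) ⊎ T (arc v u)

  data Walk : Vertex → Vertex → Set where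
    here : ∀ {v} → Walk v v
    step : ∀ {u w v} → Adj u w → Walk w v → Walk u v

  Connected : Set
  Connected = ∀ u v → Walk u v

  HasCycle : Set
  HasCycle = Σ Vertex λ x → Σ (List Vertex) λ rest →
               (2 ≤ length rest) × Unique (x ∷ rest) × Linked Adj (x ∷ rest ++ (x ∷ []))

  UnderlyingTree : Set
  UnderlyingTree = Connected × (HasCycle → Data.Empty.⊥)
    where import Data.Empty

  IsOutTree : Set
  IsOutTree = UnderlyingTree ×
              (Σ Vertex λ r → (indeg r ≡ 0) × (∀ v → v ≢ r → indeg v ≡ 1))

  isLeaf : Vertex → Bool
  isLeaf v = outdeg v ≡ᵇ 0

  isBranch : Vertex → Bool
  isBranch v = 2 ≤ᵇ outdeg v

  isBrSucc : Vertex → Bool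
  isBrSucc v = any (λ u → arc u v ∧ isBranch u) (allFin n)

  numLeaf : ℕ
  numLeaf = countV isLeaf

  numBrSucc : ℕ
  numBrSucc = countV isBrSucc

-- Every vertex u contributes [u is a branch]·d⁺(u) + 2 ≤ 2·[u is a leaf] + 2·d⁺(u)
-- (check d⁺(u) = 0, 1, ≥ 2), and every branch successor has a branch in-neighbour, so
-- |BrSucc| + 2|V| ≤ 2|Leaf| + 2|A| in any digraph. In an out-tree every vertex but the root
-- has exactly one in-arc, so |A| = |V| − 1, which leaves |BrSucc| + 2 ≤ 2|Leaf|.
module Submission where

open import Defs
open import Data.Nat using (_≤_; _*_; _∸_)

open import Data.Nat using (ℕ; zero; suc; _+_; z≤n; s≤s; _≡ᵇ_; _≤ᵇ_)
open import Data.Nat.Properties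
  using (+-*-semiring; ≤-refl; ≤-reflexive; +-mono-≤; +-monoʳ-≤; +-assoc; *-suc;
         +-cancelʳ-≤; m+n≤o⇒m≤o∸n; m≤m+n; *-identityˡ; *-identityʳ; +-identityʳ; *-comm; module ≤-Reasoning)
open import Data.Bool using (Bool; true; false; _∧_)
open import Data.Bool.ListAction using (any)
open import Data.Fin using (Fin; zero; suc; punchIn)
open import Data.Fin.Properties using (punchInᵢ≢i)
open import Data.List using (length; filterᵇ; tabulate)
open import Data.Product using (_,_)
open import Function using (_∘_)
open import Relation.Binary.PropositionalEquality
  using (_≡_; _≢_; refl; sym; trans; cong; cong₂; module ≡-Reasoning)
open import Algebra.Properties.Semiring.Sum +-*-semiring
  using (sum; sum-syntax; sum-cong-≗; ∑-distrib-+; ∑-comm; *-distribˡ-sum; sum-remove)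

indicator : Bool → ℕ
indicator true  = 1
indicator false = 0

indicator-∧ : ∀ a b → indicator (a ∧ b) ≡ indicator b * indicator a
indicator-∧ true  true  = refl
indicator-∧ true  false = refl
indicator-∧ false true  = refl
indicator-∧ false false = refl

sum-mono-≤ : ∀ {n} {f g : Fin n → ℕ} → (∀ i → f i ≤ g i) → sum f ≤ sum g
sum-mono-≤ {zero}  f≤g = z≤n
sum-mono-≤ {suc n} f≤g = +-mono-≤ (f≤g zero) (sum-mono-≤ (f≤g ∘ suc))

sum-const : ∀ n c → ∑[ i < n ] c ≡ n * c
sum-const zero    c = refl
sum-const (suc n) c = cong (c +_) (sum-const n c)

length-filterᵇ-tabulate : ∀ {A : Set} {n} (p : A → Bool) (f : Fin n → A) →
                          length (filterᵇ p (tabulate f)) ≡ ∑[ i < n ] indicator (p (f i))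
length-filterᵇ-tabulate {n = zero}  p f = refl
length-filterᵇ-tabulate {n = suc n} p f with p (f zero)
... | true  = cong suc (length-filterᵇ-tabulate p (f ∘ suc))
... | false = length-filterᵇ-tabulate p (f ∘ suc)

indicator-any-tabulate≤ : ∀ {A : Set} {n} (p : A → Bool) (f : Fin n → A) →
                          indicator (any p (tabulate f)) ≤ ∑[ i < n ] indicator (p (f i))
indicator-any-tabulate≤ {n = zero}  p f = z≤n
indicator-any-tabulate≤ {n = suc n} p f with p (f zero)
... | true  = s≤s z≤n
... | false = indicator-any-tabulate≤ p (f ∘ suc)

branch-outdeg+2≤2*leaf+2*outdeg : ∀ d → indicator (2 ≤ᵇ d) * d + 2 ≤ 2 * indicator (d ≡ᵇ 0) + 2 * d
branch-outdeg+2≤2*leaf+2*outdeg 0                = ≤-refl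
branch-outdeg+2≤2*leaf+2*outdeg 1                = ≤-refl
branch-outdeg+2≤2*leaf+2*outdeg d@(suc (suc d′)) = begin
  1 * d + 2       ≡⟨ cong (_+ 2) (*-identityˡ d) ⟩
  d + 2           ≤⟨ +-monoʳ-≤ d (m≤m+n 2 d′) ⟩
  d + d           ≡⟨ cong (d +_) (sym (+-identityʳ d)) ⟩
  2 * 0 + 2 * d   ∎
  where open ≤-Reasoning

suc-sum-0-once-1-elsewhere : ∀ {m} (f : Fin m → ℕ) (r : Fin m) →
                             f r ≡ 0 → (∀ i → i ≢ r → f i ≡ 1) → suc (sum f) ≡ m
suc-sum-0-once-1-elsewhere {suc m} f r fr≡0 f≡1 = cong suc (begin
  sum f                                  ≡⟨ sum-remove f ⟩
  f r + sum (f ∘ punchIn r)              ≡⟨ cong₂ _+_ fr≡0 (sum-cong-≗ (λ i → f≡1 (punchIn r i) (punchInᵢ≢i r i))) ⟩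
  ∑[ i < m ] 1                           ≡⟨ sum-const m 1 ⟩
  m * 1                                  ≡⟨ *-identityʳ m ⟩
  m                                      ∎)
  where open ≡-Reasoning

module _ (D : Digraph) where
  open Digraph D

  numArcs : ℕ
  numArcs = ∑[ u < n ] ∑[ v < n ] indicator (arc u v)

  countV≡∑ : (p : Vertex D → Bool) → countV D p ≡ ∑[ v < n ] indicator (p v)
  countV≡∑ p = length-filterᵇ-tabulate p (λ v → v)

  ∑-outdeg≡numArcs : ∑[ u < n ] outdeg D u ≡ numArcs
  ∑-outdeg≡numArcs = sum-cong-≗ (λ u → countV≡∑ (arc u))

  ∑-indeg≡numArcs : ∑[ v < n ] indeg D v ≡ numArcs
  ∑-indeg≡numArcs = trans (sum-cong-≗ (λ v → countV≡∑ (λ u → arc u v)))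
                          (sym (∑-comm (λ u v → indicator (arc u v))))

  numBrSucc≤∑-branch-outdeg : numBrSucc D ≤ ∑[ u < n ] (indicator (isBranch D u) * outdeg D u)
  numBrSucc≤∑-branch-outdeg = begin
    numBrSucc D
      ≡⟨ countV≡∑ (isBrSucc D) ⟩
    ∑[ v < n ] indicator (isBrSucc D v)
      ≤⟨ sum-mono-≤ (λ v → indicator-any-tabulate≤ (λ u → arc u v ∧ isBranch D u) (λ u → u)) ⟩
    ∑[ v < n ] ∑[ u < n ] indicator (arc u v ∧ isBranch D u)
      ≡⟨ ∑-comm (λ v u → indicator (arc u v ∧ isBranch D u)) ⟩
    ∑[ u < n ] ∑[ v < n ] indicator (arc u v ∧ isBranch D u)
      ≡⟨ sum-cong-≗ (λ u → sum-cong-≗ (λ v → indicator-∧ (arc u v) (isBranch D u))) ⟩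
    ∑[ u < n ] ∑[ v < n ] (indicator (isBranch D u) * indicator (arc u v))
      ≡⟨ sum-cong-≗ (λ u → sym (*-distribˡ-sum (indicator (isBranch D u)) (λ v → indicator (arc u v)))) ⟩
    ∑[ u < n ] (indicator (isBranch D u) * ∑[ v < n ] indicator (arc u v))
      ≡⟨ sum-cong-≗ (λ u → cong (indicator (isBranch D u) *_) (sym (countV≡∑ (arc u)))) ⟩
    ∑[ u < n ] (indicator (isBranch D u) * outdeg D u) ∎
    where open ≤-Reasoning

  numBrSucc+2*n≤2*numLeaf+2*numArcs : numBrSucc D + 2 * n ≤ 2 * numLeaf D + 2 * numArcs
  numBrSucc+2*n≤2*numLeaf+2*numArcs = begin
    numBrSucc D + 2 * n
      ≤⟨ +-mono-≤ numBrSucc≤∑-branch-outdeg (≤-reflexive (trans (*-comm 2 n) (sym (sum-const n 2)))) ⟩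
    ∑[ u < n ] (indicator (isBranch D u) * outdeg D u) + ∑[ u < n ] 2
      ≡⟨ sym (∑-distrib-+ (λ u → indicator (isBranch D u) * outdeg D u) (λ _ → 2)) ⟩
    ∑[ u < n ] (indicator (isBranch D u) * outdeg D u + 2)
      ≤⟨ sum-mono-≤ (λ u → branch-outdeg+2≤2*leaf+2*outdeg (outdeg D u)) ⟩
    ∑[ u < n ] (2 * indicator (isLeaf D u) + 2 * outdeg D u)
      ≡⟨ ∑-distrib-+ (λ u → 2 * indicator (isLeaf D u)) (λ u → 2 * outdeg D u) ⟩
    ∑[ u < n ] (2 * indicator (isLeaf D u)) + ∑[ u < n ] (2 * outdeg D u)
      ≡⟨ sym (cong₂ _+_ (*-distribˡ-sum 2 (indicator ∘ isLeaf D)) (*-distribˡ-sum 2 (outdeg D))) ⟩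
    2 * ∑[ u < n ] indicator (isLeaf D u) + 2 * ∑[ u < n ] outdeg D u
      ≡⟨ cong₂ (λ l a → 2 * l + 2 * a) (sym (countV≡∑ (isLeaf D))) ∑-outdeg≡numArcs ⟩
    2 * numLeaf D + 2 * numArcs ∎
    where open ≤-Reasoning

  suc-numArcs≡n : (r : Vertex D) → indeg D r ≡ 0 → (∀ v → v ≢ r → indeg D v ≡ 1) → suc numArcs ≡ n
  suc-numArcs≡n r indeg-r≡0 indeg≡1 =
    trans (cong suc (sym ∑-indeg≡numArcs)) (suc-sum-0-once-1-elsewhere (indeg D) r indeg-r≡0 indeg≡1)

mainTheorem7 : (D : Digraph) → IsOutTree D → numBrSucc D ≤ 2 * numLeaf D ∸ 2
mainTheorem7 D (_ , r , indeg-r≡0 , indeg≡1) = m+n≤o⇒m≤o∸n (numBrSucc D) (+-cancelʳ-≤ (2 * numArcs D) _ (2 * numLeaf D) (begin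
  numBrSucc D + 2 + 2 * numArcs D      ≡⟨ +-assoc (numBrSucc D) 2 (2 * numArcs D) ⟩
  numBrSucc D + (2 + 2 * numArcs D)    ≡⟨ cong (numBrSucc D +_) (sym (*-suc 2 (numArcs D))) ⟩
  numBrSucc D + 2 * suc (numArcs D)    ≡⟨ cong (λ m → numBrSucc D + 2 * m) (suc-numArcs≡n D r indeg-r≡0 indeg≡1) ⟩
  numBrSucc D + 2 * Digraph.n D        ≤⟨ numBrSucc+2*n≤2*numLeaf+2*numArcs D ⟩
  2 * numLeaf D + 2 * numArcs D        ∎))
  where open ≤-Reasoning
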